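{- Let $n\in\mathbb{N}$ with $n\geq 2$, and let $G=K_{2,n}$. Then \[\tau(G)\leq \left\lceil \frac{n+2.05}{1.24}\right\rceil.\]
   Context: All graphs are finite and simple. A list assignment $L$ for a graph $G$ assigns to each vertex $v$ a set $L(v)$ of colors; it is an $m$-assignment if $|L(v)|=m$ for all $v$. A proper $L$-coloring is a proper coloring $f$ with $f(v)\in L(v)$ for all $v$; $P(G,L)$ is the number of proper $L$-colorings. $P(G,m)$ is the chromatic polynomial (number of proper colorings with colors from $\{1,\dots,m\}$). The list color function $P_\ell(G,m)$ is the minimum of $P(G,L)$ over all $m$-assignments $L$ for $G$. The list color function threshold $\tau(G)$ is the smallest integer $k\geq\chi(G)$ such that $P_\ell(G,m)=P(G,m)$ for every integer $m\geq k$. $K_{2,n}$ is the complete bipartite graph with parts of sizes $2$ and $n$. -}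

module Defs where

open import Data.Nat using (ℕ; zero; suc; _+_; _*_; _∸_; _≤_; _<ᵇ_; _/_)
import Data.Nat.Properties as ℕP
open import Data.Bool using (Bool; true; false; T; _xor_)
open import Data.Fin using (Fin; toℕ)
import Data.Fin as F
open import Data.Fin.Properties using (all?)
open import Data.List using (List; []; _∷_; length; filter; concatMap; map; upTo)
open import Data.List.Relation.Unary.Unique.Propositional using (Unique)
open import Data.Vec.Functional using (Vector) renaming (_∷_ to _∷ᵛ_)
open import Data.Product using (Σ; ∃; _×_; _,_)
open import Relation.Binary.PropositionalEquality using (_≡_; _≢_)
open import Relation.Nullary using (Dec; ¬?)
open import Relation.Nullary.Decidable using (_→-dec_)
open import Relation.Unary using (Decidable)

record Graph : Set where
  field
    size : ℕ
    adj  : Fin size → Fin size → Bool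
    sym  : ∀ u v → adj u v ≡ adj v u
    irr  : ∀ v → adj v v ≡ false
open Graph public

Proper : (G : Graph) → Vector ℕ (size G) → Set
Proper G f = ∀ u v → T (adj G u v) → f u ≢ f v

proper? : (G : Graph) → Decidable (Proper G)
proper? G f = all? (λ u → all? (λ v →
  Relation.Nullary.Decidable.T? (adj G u v) →-dec ¬? (f u ℕP.≟ f v)))
  where import Relation.Nullary.Decidable

choices : ∀ k → (Fin k → List ℕ) → List (Vector ℕ k)
choices zero    L = (λ ()) ∷ []
choices (suc k) L =
  concatMap (λ c → map (λ g → c ∷ᵛ g) (choices k (λ v → L (F.suc v)))) (L F.zero)

IsAssignment : (G : Graph) → ℕ → (Fin (size G) → List ℕ) → Set
IsAssignment G m L = ∀ v → Unique (L v) × length (L v) ≡ m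

P[_,_] : (G : Graph) → (Fin (size G) → List ℕ) → ℕ
P[ G , L ] = length (filter (proper? G) (choices (size G) L))

chrom : Graph → ℕ → ℕ
chrom G m = P[ G , (λ _ → map suc (upTo m)) ]

ListColorFunctionIs : Graph → ℕ → ℕ → Set
ListColorFunctionIs G m p =
  (Σ (Fin (size G) → List ℕ) λ L → IsAssignment G m L × P[ G , L ] ≡ p)
  × (∀ L → IsAssignment G m L → p ≤ P[ G , L ])

Colorable : Graph → ℕ → Set
Colorable G k = Σ (Vector (Fin k) (size G)) λ c → Proper G (λ v → toℕ (c v))

-- τ(G) ≤ K: there is an integer k with χ(G) ≤ k ≤ K such that
-- P_ℓ(G, m) = P(G, m) for all m ≥ k  (τ(G) is the least such k).
ThresholdAtMost : Graph → ℕ → Set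
ThresholdAtMost G K =
  ∃ λ k → Colorable G k × k ≤ K × (∀ m → k ≤ m → ListColorFunctionIs G m (chrom G m))

-- K_{2,n}: vertices 0,1 form one side, 2,…,n+1 the other.
side : ∀ {k} → Fin k → Bool
side v = toℕ v <ᵇ 2

K2 : ℕ → Graph
K2 n = record
  { size = 2 + n
  ; adj  = λ u v → side u xor side v
  ; sym  = λ u v → xor-comm (side u) (side v)
  ; irr  = λ v → xor-self (side v)
  }
  where
  xor-comm : ∀ a b → a xor b ≡ b xor a
  xor-comm true true = _≡_.refl
  xor-comm true false = _≡_.refl
  xor-comm false true = _≡_.refl
  xor-comm false false = _≡_.refl
  xor-self : ∀ a → a xor a ≡ false
  xor-self true = _≡_.refl
  xor-self false = _≡_.refl

ceilDiv : ℕ → ℕ → ℕ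
ceilDiv a zero = 0
ceilDiv a (suc b) = (a + b) / suc b

-- ⌈ (n + 2.05) / 1.24 ⌉ = ⌈ (100 n + 205) / 124 ⌉
bound : ℕ → ℕ
bound n = ceilDiv (100 * n + 205) 124

module Submission where

-- Write m = X + 2 and u, w for the vertices of the 2-side. For an m-assignment L,
-- P(K₂,ₙ, L) = Σ_{x ∈ L(u)} Σ_{y ∈ L(w)} Πᵢ |L(vᵢ) ∖ {x, y}|, where each factor is at least X + 1
-- if x = y, and at least X, plus one when x and y are not both in L(vᵢ), if x ≠ y; the standard
-- assignment {1, …, m} attains these bounds. So L can only lose through the m − |L(u) ∩ L(w)|
-- missing equal pairs, each costing (X + 1)ⁿ − Xⁿ, while each vᵢ supplies at least
-- (3m/4)(m − |L(u) ∩ L(w)|) pairs with the extra colour, each gaining at least Xⁿ⁻¹. The gain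
-- covers the loss when 4X(X + 1)ⁿ ≤ 4Xⁿ⁺¹ + 3nmXⁿ, which holds as soon as 124m ≥ 100n + 205.

open import Data.Bool using (Bool; true; false; T; _∧_; _∨_; not; if_then_else_)
open import Data.Bool.Properties using (T-≡; T-∧; ∧-comm; ∧-zeroʳ; ∧-identityʳ; ∨-zeroʳ)
open import Data.Empty using (⊥-elim)
open import Data.Fin using (Fin; toℕ; fromℕ<) renaming (zero to fz; suc to fs)
open import Data.Fin.Properties using (all?; toℕ-fromℕ<)
open import Data.List using (List; []; _∷_; length; filter; map; concatMap; _++_; allFin; upTo)
open import Data.List.Properties using (length-tabulate; map-tabulate; length-map; length-upTo)
open import Data.List.Relation.Unary.All as All using (All; []; _∷_)
open import Data.List.Relation.Unary.AllPairs using ([]; _∷_)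
open import Data.List.Relation.Unary.Unique.Propositional using (Unique)
open import Data.List.Relation.Unary.Unique.Propositional.Properties using (map⁺; upTo⁺)
open import Data.Nat using (ℕ; zero; suc; _+_; _*_; _^_; _/_; _%_; _≤_; _<_; z≤n; s≤s; _≡ᵇ_; NonZero;
  ⌊_/2⌋; ⌈_/2⌉; _≤?_; _<?_)
open import Data.Nat.DivMod using (m≡m%n+[m/n]*n; m%n<n)
open import Data.Nat.Properties
open import Algebra.Properties.CommutativeSemigroup +-commutativeSemigroup
  using () renaming (interchange to +-interchange)
open import Algebra.Properties.CommutativeSemigroup *-commutativeSemigroup
  using () renaming (x∙yz≈y∙xz to x*[y*z]≡y*[x*z])
open import Data.Nat.Tactic.RingSolver using (solve-∀)
open import Data.Product using (_,_; _×_; proj₁; proj₂)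
open import Data.Sum using (inj₁; inj₂)
open import Data.Unit using (tt)
open import Data.Vec.Functional using (Vector) renaming (_∷_ to _∷ᵛ_)
open import Function using (_∘_)
open import Function.Bundles using (Equivalence; mk⇔)
open import Relation.Binary.PropositionalEquality
open import Relation.Nullary using (¬_; Dec; does)
open import Relation.Nullary.Decidable using (does-⇔; T?; from-yes; _→-dec_; yes; no)

open import Defs hiding (sym)

private
  variable
    A B : Set

𝟙 : Bool → ℕ
𝟙 true = 1
𝟙 false = 0

∑ : List A → (A → ℕ) → ℕ
∑ [] f = 0
∑ (x ∷ xs) f = f x + ∑ xs f

syntax ∑ xs (λ x → e) = ∑[ x ∈ xs ] e

count : (A → Bool) → List A → ℕ
count p xs = ∑[ x ∈ xs ] 𝟙 (p x)

_∈ᵇ_ : ℕ → List ℕ → Bool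
x ∈ᵇ [] = false
x ∈ᵇ (y ∷ ys) = (y ≡ᵇ x) ∨ (x ∈ᵇ ys)

≡ᵇ-true⇒≡ : ∀ a b → (a ≡ᵇ b) ≡ true → a ≡ b
≡ᵇ-true⇒≡ a b e = ≡ᵇ⇒≡ a b (Equivalence.from T-≡ e)

≡ᵇ-refl : ∀ a → (a ≡ᵇ a) ≡ true
≡ᵇ-refl a = Equivalence.to T-≡ (≡⇒≡ᵇ a a refl)

≢⇒≡ᵇ-false : ∀ a b → a ≢ b → (a ≡ᵇ b) ≡ false
≢⇒≡ᵇ-false a b a≢b with a ≡ᵇ b in e
... | true = ⊥-elim (a≢b (≡ᵇ-true⇒≡ a b e))
... | false = refl

≡ᵇ-sym : ∀ a b → (a ≡ᵇ b) ≡ (b ≡ᵇ a)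
≡ᵇ-sym zero zero = refl
≡ᵇ-sym zero (suc b) = refl
≡ᵇ-sym (suc a) zero = refl
≡ᵇ-sym (suc a) (suc b) = ≡ᵇ-sym a b

∑-cong : ∀ xs {f g : A → ℕ} → (∀ x → f x ≡ g x) → ∑ xs f ≡ ∑ xs g
∑-cong [] e = refl
∑-cong (x ∷ xs) e = cong₂ _+_ (e x) (∑-cong xs e)

∑-mono : ∀ {xs} {f g : A → ℕ} → All (λ x → f x ≤ g x) xs → ∑ xs f ≤ ∑ xs g
∑-mono [] = z≤n
∑-mono (le ∷ les) = +-mono-≤ le (∑-mono les)

∑-mono′ : ∀ xs {f g : A → ℕ} → (∀ x → f x ≤ g x) → ∑ xs f ≤ ∑ xs g
∑-mono′ xs f≤g = ∑-mono (All.universal f≤g xs)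

∑-+ : ∀ xs (f g : A → ℕ) → ∑[ x ∈ xs ] (f x + g x) ≡ ∑ xs f + ∑ xs g
∑-+ [] f g = refl
∑-+ (x ∷ xs) f g = trans (cong (f x + g x +_) (∑-+ xs f g)) (+-interchange (f x) (g x) _ _)

∑-*ˡ : ∀ xs k (f : A → ℕ) → ∑[ x ∈ xs ] (k * f x) ≡ k * ∑ xs f
∑-*ˡ [] k f = sym (*-zeroʳ k)
∑-*ˡ (x ∷ xs) k f = trans (cong (k * f x +_) (∑-*ˡ xs k f)) (sym (*-distribˡ-+ k (f x) _))

∑-+-*ˡ : ∀ xs (f : A → ℕ) k g → ∑[ x ∈ xs ] (f x + k * g x) ≡ ∑ xs f + k * ∑ xs g
∑-+-*ˡ xs f k g = trans (∑-+ xs f _) (cong (∑ xs f +_) (∑-*ˡ xs k g))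

∑-const : ∀ (xs : List A) k → ∑[ _ ∈ xs ] k ≡ length xs * k
∑-const [] k = refl
∑-const (x ∷ xs) k = cong (k +_) (∑-const xs k)

∑-𝟙-* : ∀ xs (p : A → Bool) k → ∑[ x ∈ xs ] (𝟙 (p x) * k) ≡ count p xs * k
∑-𝟙-* [] p k = refl
∑-𝟙-* (x ∷ xs) p k = trans (cong (𝟙 (p x) * k +_) (∑-𝟙-* xs p k)) (sym (*-distribʳ-+ k (𝟙 (p x)) _))

∑-++ : ∀ xs ys (f : A → ℕ) → ∑ (xs ++ ys) f ≡ ∑ xs f + ∑ ys f
∑-++ [] ys f = refl
∑-++ (x ∷ xs) ys f = trans (cong (f x +_) (∑-++ xs ys f)) (sym (+-assoc (f x) _ _))

∑-concatMap : ∀ xs (g : A → List B) (f : B → ℕ) →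
  ∑ (concatMap g xs) f ≡ ∑[ x ∈ xs ] ∑ (g x) f
∑-concatMap [] g f = refl
∑-concatMap (x ∷ xs) g f = trans (∑-++ (g x) (concatMap g xs) f) (cong (∑ (g x) f +_) (∑-concatMap xs g f))

∑-map : ∀ xs (g : A → B) (f : B → ℕ) → ∑ (map g xs) f ≡ ∑[ x ∈ xs ] f (g x)
∑-map [] g f = refl
∑-map (x ∷ xs) g f = cong (f (g x) +_) (∑-map xs g f)

∑-comm : ∀ xs ys (f : A → B → ℕ) →
  ∑[ x ∈ xs ] ∑[ y ∈ ys ] f x y ≡ ∑[ y ∈ ys ] ∑[ x ∈ xs ] f x y
∑-comm [] ys f = sym (trans (∑-const ys 0) (*-zeroʳ (length ys)))
∑-comm (x ∷ xs) ys f = trans (cong (∑ ys (f x) +_) (∑-comm xs ys f)) (sym (∑-+ ys (f x) _))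

length-filter : {P : A → Set} (P? : ∀ x → Dec (P x)) (xs : List A) →
  length (filter P? xs) ≡ count (λ x → does (P? x)) xs
length-filter P? [] = refl
length-filter P? (x ∷ xs) with does (P? x)
... | true = cong suc (length-filter P? xs)
... | false = length-filter P? xs

count-∧ˡ : ∀ xs b (q : A → Bool) → count (λ x → b ∧ q x) xs ≡ 𝟙 b * count q xs
count-∧ˡ xs true q = sym (+-identityʳ _)
count-∧ˡ [] false q = refl
count-∧ˡ (x ∷ xs) false q = count-∧ˡ xs false q

count-all : ∀ {xs} (p : A → Bool) → All (λ x → p x ≡ true) xs → count p xs ≡ length xs
count-all p [] = refl
count-all {xs = x ∷ _} p (px ∷ pxs) rewrite px = cong suc (count-all p pxs)

count-true : ∀ (xs : List A) → count (λ _ → true) xs ≡ length xs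
count-true xs = count-all (λ _ → true) (All.universal (λ _ → refl) xs)

count-split : ∀ xs (p r : A → Bool) →
  count p xs ≡ count (λ x → p x ∧ r x) xs + count (λ x → p x ∧ not (r x)) xs
count-split [] p r = refl
count-split (x ∷ xs) p r with p x | r x
... | true | true = cong suc (count-split xs p r)
... | true | false = trans (cong suc (count-split xs p r)) (sym (+-suc _ _))
... | false | _ = count-split xs p r

count≤length : ∀ xs (p : A → Bool) → count p xs ≤ length xs
count≤length xs p = subst (count p xs ≤_) (trans (sym (count-split xs (λ _ → true) p)) (count-true xs))
  (m≤m+n (count p xs) _)

count-disjoint : ∀ xs (p q : A → Bool) → (∀ x → 𝟙 (p x) + 𝟙 (q x) ≤ 1) →
  count p xs + count q xs ≤ length xs
count-disjoint [] p q disj = z≤n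
count-disjoint (x ∷ xs) p q disj =
  subst (_≤ suc (length xs)) (+-interchange (𝟙 (p x)) (𝟙 (q x)) _ _)
    (+-mono-≤ (disj x) (count-disjoint xs p q disj))

∈ᵇ-self : ∀ xs → All (λ x → (x ∈ᵇ xs) ≡ true) xs
∈ᵇ-self [] = []
∈ᵇ-self (x ∷ xs) = cong (_∨ (x ∈ᵇ xs)) (≡ᵇ-refl x)
  ∷ All.map (λ {z} z∈xs → trans (cong ((x ≡ᵇ z) ∨_) z∈xs) (∨-zeroʳ _)) (∈ᵇ-self xs)

∉⇒∈ᵇ-false : ∀ x xs → All (x ≢_) xs → (x ∈ᵇ xs) ≡ false
∉⇒∈ᵇ-false x [] [] = refl
∉⇒∈ᵇ-false x (y ∷ ys) (x≢y ∷ x∉ys)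
  rewrite ≢⇒≡ᵇ-false y x (x≢y ∘ sym) = ∉⇒∈ᵇ-false x ys x∉ys

count-∧-≢ : ∀ (p : ℕ → Bool) x zs → All (x ≢_) zs →
  count (λ c → p c ∧ not (c ≡ᵇ x)) zs ≡ count p zs
count-∧-≢ p x [] [] = refl
count-∧-≢ p x (z ∷ zs) (x≢z ∷ x∉zs) rewrite ≢⇒≡ᵇ-false z x (x≢z ∘ sym) with p z
... | true = cong suc (count-∧-≢ p x zs x∉zs)
... | false = count-∧-≢ p x zs x∉zs

count-remove : ∀ (p : ℕ → Bool) x xs → Unique xs →
  count (λ c → p c ∧ not (c ≡ᵇ x)) xs + 𝟙 (p x ∧ (x ∈ᵇ xs)) ≡ count p xs
count-remove p x [] [] = cong 𝟙 (∧-zeroʳ (p x))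
count-remove p x (z ∷ zs) (z∉zs ∷ zs!) with z ≡ᵇ x in e
... | true with ≡ᵇ-true⇒≡ z x e
...   | refl rewrite count-∧-≢ p z zs z∉zs with p z
...     | true = +-comm (count p zs) 1
...     | false = +-identityʳ _
count-remove p x (z ∷ zs) (z∉zs ∷ zs!) | false with p z
... | true = cong suc (count-remove p x zs zs!)
... | false = count-remove p x zs zs!

count-≡ᵇ : ∀ x xs → Unique xs → count (_≡ᵇ x) xs ≡ 𝟙 (x ∈ᵇ xs)
count-≡ᵇ x [] [] = refl
count-≡ᵇ x (z ∷ zs) (z∉zs ∷ zs!) with z ≡ᵇ x in e
... | true with ≡ᵇ-true⇒≡ z x e
...   | refl = cong suc (count-none zs z∉zs)
  where
  count-none : ∀ zs → All (z ≢_) zs → count (_≡ᵇ z) zs ≡ 0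
  count-none [] [] = refl
  count-none (y ∷ ys) (z≢y ∷ z∉ys) rewrite ≢⇒≡ᵇ-false y z (z≢y ∘ sym) = count-none ys z∉ys
count-≡ᵇ x (z ∷ zs) (z∉zs ∷ zs!) | false = count-≡ᵇ x zs zs!

count-∈ᵇ-swap : ∀ (r : ℕ → Bool) xs ys → Unique xs → Unique ys →
  count (λ x → (x ∈ᵇ ys) ∧ r x) xs ≡ count (λ y → (y ∈ᵇ xs) ∧ r y) ys
count-∈ᵇ-swap r [] ys [] ys! = sym (count-∧ˡ ys false r)
count-∈ᵇ-swap r (x ∷ xs) ys (x∉xs ∷ xs!) ys! = begin
    𝟙 ((x ∈ᵇ ys) ∧ r x) + count (λ z → (z ∈ᵇ ys) ∧ r z) xs
  ≡⟨ cong (𝟙 ((x ∈ᵇ ys) ∧ r x) +_) (count-∈ᵇ-swap r xs ys xs! ys!) ⟩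
    𝟙 ((x ∈ᵇ ys) ∧ r x) + count (λ y → (y ∈ᵇ xs) ∧ r y) ys
  ≡⟨ +-comm (𝟙 ((x ∈ᵇ ys) ∧ r x)) _ ⟩
    count (λ y → (y ∈ᵇ xs) ∧ r y) ys + 𝟙 ((x ∈ᵇ ys) ∧ r x)
  ≡⟨ cong₂ _+_ (∑-cong ys (λ y → cong 𝟙 (sym (drop-x y)))) (cong 𝟙 head-x) ⟩
    count (λ y → q y ∧ not (y ≡ᵇ x)) ys + 𝟙 (q x ∧ (x ∈ᵇ ys))
  ≡⟨ count-remove q x ys ys! ⟩
    count q ys
  ∎
  where
  open ≡-Reasoning
  q : ℕ → Bool
  q y = ((x ≡ᵇ y) ∨ (y ∈ᵇ xs)) ∧ r y
  head-x : (x ∈ᵇ ys) ∧ r x ≡ q x ∧ (x ∈ᵇ ys)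
  head-x rewrite ≡ᵇ-refl x = ∧-comm (x ∈ᵇ ys) (r x)
  drop-x : ∀ y → q y ∧ not (y ≡ᵇ x) ≡ (y ∈ᵇ xs) ∧ r y
  drop-x y with y ≡ᵇ x in e
  ... | true with ≡ᵇ-true⇒≡ y x e
  ...   | refl rewrite ∉⇒∈ᵇ-false y xs x∉xs = ∧-zeroʳ _
  drop-x y | false rewrite ≡ᵇ-sym x y | e = ∧-identityʳ _

∑-allFin-suc : ∀ n (f : Fin (suc n) → ℕ) → ∑ (allFin (suc n)) f ≡ f fz + ∑ (allFin n) (f ∘ fs)
∑-allFin-suc n f = cong (f fz +_)
  (trans (cong (λ is → ∑ is f) (sym (map-tabulate (λ i → i) fs))) (∑-map (allFin n) fs f))

∑-allFin-const : ∀ n k → ∑[ _ ∈ allFin n ] k ≡ n * k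
∑-allFin-const n k = trans (∑-const (allFin n) k) (cong (_* k) (length-tabulate {n = n} (λ i → i)))

∏ᶠ : ∀ n → (Fin n → ℕ) → ℕ
∏ᶠ zero f = 1
∏ᶠ (suc n) f = f fz * ∏ᶠ n (f ∘ fs)

syntax ∏ᶠ n (λ i → e) = ∏[ i < n ] e

∏-mono : ∀ n {f g : Fin n → ℕ} → (∀ i → f i ≤ g i) → ∏ᶠ n f ≤ ∏ᶠ n g
∏-mono zero f≤g = ≤-refl
∏-mono (suc n) f≤g = *-mono-≤ (f≤g fz) (∏-mono n (f≤g ∘ fs))

∏-cong : ∀ n {f g : Fin n → ℕ} → (∀ i → f i ≡ g i) → ∏ᶠ n f ≡ ∏ᶠ n g
∏-cong zero _ = refl
∏-cong (suc n) f≡g = cong₂ _*_ (f≡g fz) (∏-cong n (f≡g ∘ fs))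

∏-const : ∀ n k → ∏[ _ < n ] k ≡ k ^ n
∏-const zero k = refl
∏-const (suc n) k = cong (k *_) (∏-const n k)

-- ∏ (X + bᵢ) ≥ Xⁿ + Xⁿ⁻¹ ∑ bᵢ, multiplied by X so that no Xⁿ⁻¹ occurs.
∏-lower-bound-linear : ∀ n X (b f : Fin n → ℕ) → (∀ i → X + b i ≤ f i) →
  X ^ suc n + X ^ n * ∑ (allFin n) b ≤ X * ∏ᶠ n f
∏-lower-bound-linear zero X b f _ = ≤-reflexive (+-identityʳ (X * 1))
∏-lower-bound-linear (suc n) X b f X+b≤f = begin
    X ^ suc (suc n) + X ^ suc n * ∑ (allFin (suc n)) b
  ≡⟨ cong (λ s → X ^ suc (suc n) + X ^ suc n * s) (∑-allFin-suc n b) ⟩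
    X * (X * X ^ n) + X * X ^ n * (b fz + S)
  ≤⟨ m≤m+n _ (b fz * (X ^ n * S)) ⟩
    X * (X * X ^ n) + X * X ^ n * (b fz + S) + b fz * (X ^ n * S)
  ≡⟨ expand X (X ^ n) (b fz) S ⟩
    (X + b fz) * (X ^ suc n + X ^ n * S)
  ≤⟨ *-mono-≤ (X+b≤f fz) (∏-lower-bound-linear n X (b ∘ fs) (f ∘ fs) (X+b≤f ∘ fs)) ⟩
    f fz * (X * ∏ᶠ n (f ∘ fs))
  ≡⟨ x*[y*z]≡y*[x*z] (f fz) X _ ⟩
    X * ∏ᶠ (suc n) f
  ∎
  where
  open ≤-Reasoning
  S = ∑ (allFin n) (b ∘ fs)
  expand : ∀ X Y b S → X * (X * Y) + X * Y * (b + S) + b * (Y * S) ≡ (X + b) * (X * Y + Y * S)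
  expand = solve-∀

-- Proper colourings of K₂,ₙ

allᶠ : ∀ k → (Fin k → Bool) → Bool
allᶠ zero f = true
allᶠ (suc k) f = f fz ∧ allᶠ k (f ∘ fs)

T-allᶠ⁻ : ∀ k f → T (allᶠ k f) → ∀ i → T (f i)
T-allᶠ⁻ (suc k) f t fz = proj₁ (Equivalence.to T-∧ t)
T-allᶠ⁻ (suc k) f t (fs i) = T-allᶠ⁻ k (f ∘ fs) (proj₂ (Equivalence.to T-∧ t)) i

T-allᶠ⁺ : ∀ k f → (∀ i → T (f i)) → T (allᶠ k f)
T-allᶠ⁺ zero f _ = tt
T-allᶠ⁺ (suc k) f t = Equivalence.from T-∧ (t fz , T-allᶠ⁺ k (f ∘ fs) (t ∘ fs))

count-choices : ∀ k (R : Fin k → ℕ → Bool) (L : Fin k → List ℕ) →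
  count (λ g → allᶠ k (λ i → R i (g i))) (choices k L) ≡ ∏[ i < k ] count (R i) (L i)
count-choices zero R L = refl
count-choices (suc k) R L = begin
    count all-R (concatMap (λ c → map (c ∷ᵛ_) rest) (L fz))
  ≡⟨ ∑-concatMap (L fz) (λ c → map (c ∷ᵛ_) rest) (𝟙 ∘ all-R) ⟩
    ∑[ c ∈ L fz ] count all-R (map (c ∷ᵛ_) rest)
  ≡⟨ ∑-cong (L fz) (λ c → begin
        count all-R (map (c ∷ᵛ_) rest)
      ≡⟨ ∑-map rest (c ∷ᵛ_) (𝟙 ∘ all-R) ⟩
        count (λ g → R fz c ∧ allᶠ k (λ i → R (fs i) (g i))) rest
      ≡⟨ count-∧ˡ rest (R fz c) _ ⟩
        𝟙 (R fz c) * count (λ g → allᶠ k (λ i → R (fs i) (g i))) rest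
      ≡⟨ cong (𝟙 (R fz c) *_) (count-choices k (R ∘ fs) (L ∘ fs)) ⟩
        𝟙 (R fz c) * ∏[ i < k ] count (R (fs i)) (L (fs i))
      ∎) ⟩
    ∑[ c ∈ L fz ] (𝟙 (R fz c) * ∏[ i < k ] count (R (fs i)) (L (fs i)))
  ≡⟨ ∑-𝟙-* (L fz) (R fz) _ ⟩
    count (R fz) (L fz) * ∏[ i < k ] count (R (fs i)) (L (fs i))
  ∎
  where
  open ≡-Reasoning
  rest = choices k (L ∘ fs)
  all-R : Vector ℕ (suc k) → Bool
  all-R g = allᶠ (suc k) (λ i → R i (g i))

avoids : ℕ → ℕ → ℕ → Bool
avoids x y c = not (c ≡ᵇ x) ∧ not (c ≡ᵇ y)

available : ℕ → ℕ → List ℕ → ℕ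
available x y = count (avoids x y)

≢⇒T-avoids : ∀ {x y c} → c ≢ x → c ≢ y → T (avoids x y c)
≢⇒T-avoids {x} {y} {c} c≢x c≢y rewrite ≢⇒≡ᵇ-false c x c≢x | ≢⇒≡ᵇ-false c y c≢y = tt

T-avoids⇒≢ : ∀ {x y c} → T (avoids x y c) → c ≢ x × c ≢ y
T-avoids⇒≢ {x} {y} {c} t = not-≡ᵇ⇒≢ (proj₁ t∧) , not-≡ᵇ⇒≢ (proj₂ t∧)
  where
  t∧ = Equivalence.to T-∧ t
  not-≡ᵇ⇒≢ : ∀ {z} → T (not (c ≡ᵇ z)) → c ≢ z
  not-≡ᵇ⇒≢ t refl rewrite ≡ᵇ-refl c = t

module _ {n x y : ℕ} {g : Vector ℕ n} where

  proper⇒avoids : Proper (K2 n) (x ∷ᵛ y ∷ᵛ g) → ∀ i → T (avoids x y (g i))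
  proper⇒avoids proper i =
    ≢⇒T-avoids (λ e → proper fz (fs (fs i)) tt (sym e)) (λ e → proper (fs fz) (fs (fs i)) tt (sym e))

  avoids⇒proper : (∀ i → T (avoids x y (g i))) → Proper (K2 n) (x ∷ᵛ y ∷ᵛ g)
  avoids⇒proper av fz (fs (fs i)) _ = proj₁ (T-avoids⇒≢ (av i)) ∘ sym
  avoids⇒proper av (fs fz) (fs (fs i)) _ = proj₂ (T-avoids⇒≢ (av i)) ∘ sym
  avoids⇒proper av (fs (fs i)) fz _ = proj₁ (T-avoids⇒≢ (av i))
  avoids⇒proper av (fs (fs i)) (fs fz) _ = proj₂ (T-avoids⇒≢ (av i))
  avoids⇒proper av fz fz ()
  avoids⇒proper av fz (fs fz) ()
  avoids⇒proper av (fs fz) fz ()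
  avoids⇒proper av (fs fz) (fs fz) ()
  avoids⇒proper av (fs (fs i)) (fs (fs j)) ()

  does-proper-K2 : does (proper? (K2 n) (x ∷ᵛ y ∷ᵛ g)) ≡ allᶠ n (λ i → avoids x y (g i))
  does-proper-K2 = does-⇔ (mk⇔ (T-allᶠ⁺ n _ ∘ proper⇒avoids) (avoids⇒proper ∘ T-allᶠ⁻ n _))
    (proper? (K2 n) (x ∷ᵛ y ∷ᵛ g)) (T? _)

P-K2 : ∀ n (L : Fin (2 + n) → List ℕ) →
  P[ K2 n , L ] ≡ ∑[ x ∈ L fz ] ∑[ y ∈ L (fs fz) ] ∏[ i < n ] available x y (L (fs (fs i)))
P-K2 n L = begin
    length (filter (proper? (K2 n)) (choices (2 + n) L))
  ≡⟨ length-filter (proper? (K2 n)) (choices (2 + n) L) ⟩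
    count proper (choices (2 + n) L)
  ≡⟨ ∑-concatMap (L fz) (λ x → map (x ∷ᵛ_) (choices (suc n) (L ∘ fs))) (𝟙 ∘ proper) ⟩
    ∑[ x ∈ L fz ] count proper (map (x ∷ᵛ_) (choices (suc n) (L ∘ fs)))
  ≡⟨ ∑-cong (L fz) (λ x → begin
      count proper (map (x ∷ᵛ_) (choices (suc n) (L ∘ fs)))
    ≡⟨ ∑-map (choices (suc n) (L ∘ fs)) (x ∷ᵛ_) (𝟙 ∘ proper) ⟩
      count (λ h → proper (x ∷ᵛ h)) (concatMap (λ y → map (y ∷ᵛ_) rest) (L (fs fz)))
    ≡⟨ ∑-concatMap (L (fs fz)) (λ y → map (y ∷ᵛ_) rest) (λ h → 𝟙 (proper (x ∷ᵛ h))) ⟩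
      ∑[ y ∈ L (fs fz) ] count (λ h → proper (x ∷ᵛ h)) (map (y ∷ᵛ_) rest)
    ≡⟨ ∑-cong (L (fs fz)) (λ y → ∑-map rest (y ∷ᵛ_) (λ h → 𝟙 (proper (x ∷ᵛ h)))) ⟩
      ∑[ y ∈ L (fs fz) ] count (λ g → proper (x ∷ᵛ y ∷ᵛ g)) rest
    ∎) ⟩
    ∑[ x ∈ L fz ] ∑[ y ∈ L (fs fz) ] count (λ g → proper (x ∷ᵛ y ∷ᵛ g)) rest
  ≡⟨ ∑-cong (L fz) (λ x → ∑-cong (L (fs fz)) (λ y → begin
      count (λ g → proper (x ∷ᵛ y ∷ᵛ g)) rest
    ≡⟨ ∑-cong rest (λ g → cong 𝟙 (does-proper-K2 {n} {x} {y} {g})) ⟩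
      count (λ g → allᶠ n (λ i → avoids x y (g i))) rest
    ≡⟨ count-choices n (λ _ → avoids x y) (L ∘ fs ∘ fs) ⟩
      ∏[ i < n ] available x y (L (fs (fs i)))
    ∎)) ⟩
    ∑[ x ∈ L fz ] ∑[ y ∈ L (fs fz) ] ∏[ i < n ] available x y (L (fs (fs i)))
  ∎
  where
  open ≡-Reasoning
  proper : Vector ℕ (2 + n) → Bool
  proper f = does (proper? (K2 n) f)
  rest = choices n (L ∘ fs ∘ fs)

available+hits : ∀ x y L → Unique L →
  available x y L + 𝟙 (x ∈ᵇ L) + 𝟙 (not (y ≡ᵇ x) ∧ (y ∈ᵇ L)) ≡ length L
available+hits x y L L! = begin
    available x y L + 𝟙 (x ∈ᵇ L) + 𝟙 (not (y ≡ᵇ x) ∧ (y ∈ᵇ L))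
  ≡⟨ +-assoc (available x y L) _ _ ⟩
    available x y L + (𝟙 (x ∈ᵇ L) + 𝟙 (not (y ≡ᵇ x) ∧ (y ∈ᵇ L)))
  ≡⟨ cong (available x y L +_) (+-comm (𝟙 (x ∈ᵇ L)) _) ⟩
    available x y L + (𝟙 (not (y ≡ᵇ x) ∧ (y ∈ᵇ L)) + 𝟙 (x ∈ᵇ L))
  ≡⟨ sym (+-assoc (available x y L) _ _) ⟩
    available x y L + 𝟙 (not (y ≡ᵇ x) ∧ (y ∈ᵇ L)) + 𝟙 (x ∈ᵇ L)
  ≡⟨ cong (_+ 𝟙 (x ∈ᵇ L)) (count-remove (λ c → not (c ≡ᵇ x)) y L L!) ⟩
    count (λ c → not (c ≡ᵇ x)) L + 𝟙 (x ∈ᵇ L)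
  ≡⟨ count-remove (λ _ → true) x L L! ⟩
    count (λ _ → true) L
  ≡⟨ count-true L ⟩
    length L
  ∎
  where open ≡-Reasoning

bonus : List ℕ → ℕ → ℕ → Bool
bonus L x y = not (x ≡ᵇ y) ∧ not ((x ∈ᵇ L) ∧ (y ∈ᵇ L))

-- e, a, b stand for x ≡ y, x ∈ L and y ∈ L.
hit-budget : ∀ e a b → 𝟙 (not e ∧ not (a ∧ b)) + 𝟙 e + (𝟙 a + 𝟙 (not e ∧ b)) ≤ 2
hit-budget true true _ = ≤-refl
hit-budget true false _ = n≤1+n 1
hit-budget false true true = ≤-refl
hit-budget false true false = ≤-refl
hit-budget false false true = ≤-refl
hit-budget false false false = n≤1+n 1

module _ {X : ℕ} {L : List ℕ} (L! : Unique L) (|L| : length L ≡ 2 + X) where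

  available-lower : ∀ x y → X + 𝟙 (bonus L x y) + 𝟙 (x ≡ᵇ y) ≤ available x y L
  available-lower x y = +-cancelʳ-≤ (𝟙 (x ∈ᵇ L) + 𝟙 hit-y) _ _ (begin
      X + 𝟙 (bonus L x y) + 𝟙 (x ≡ᵇ y) + (𝟙 (x ∈ᵇ L) + 𝟙 hit-y)
    ≡⟨ trans (cong (_+ (𝟙 (x ∈ᵇ L) + 𝟙 hit-y)) (+-assoc X _ _)) (+-assoc X _ _) ⟩
      X + (𝟙 (bonus L x y) + 𝟙 (x ≡ᵇ y) + (𝟙 (x ∈ᵇ L) + 𝟙 hit-y))
    ≤⟨ +-monoʳ-≤ X (subst (λ e → 𝟙 (bonus L x y) + 𝟙 (x ≡ᵇ y) + (𝟙 (x ∈ᵇ L) + 𝟙 (not e ∧ (y ∈ᵇ L))) ≤ 2)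
                          (≡ᵇ-sym x y) (hit-budget (x ≡ᵇ y) (x ∈ᵇ L) (y ∈ᵇ L))) ⟩
      X + 2
    ≡⟨ +-comm X 2 ⟩
      2 + X
    ≡⟨ sym (trans (available+hits x y L L!) |L|) ⟩
      available x y L + 𝟙 (x ∈ᵇ L) + 𝟙 hit-y
    ≡⟨ +-assoc (available x y L) _ _ ⟩
      available x y L + (𝟙 (x ∈ᵇ L) + 𝟙 hit-y)
    ∎)
    where
    open ≤-Reasoning
    hit-y = not (y ≡ᵇ x) ∧ (y ∈ᵇ L)

  available-members : ∀ {x y} → (x ∈ᵇ L) ≡ true → (y ∈ᵇ L) ≡ true →
    available x y L + 𝟙 (not (x ≡ᵇ y)) ≡ 1 + X
  available-members {x} {y} x∈L y∈L = suc-injective (begin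
      suc (available x y L + 𝟙 (not (x ≡ᵇ y)))
    ≡⟨ sym (trans (+-assoc (available x y L) 1 _) (+-suc (available x y L) _)) ⟩
      available x y L + 1 + 𝟙 (not (x ≡ᵇ y))
    ≡⟨ cong₂ (λ a b → available x y L + 𝟙 a + 𝟙 b) (sym x∈L)
         (trans (cong not (≡ᵇ-sym x y)) (sym (trans (cong (not (y ≡ᵇ x) ∧_) y∈L) (∧-identityʳ _)))) ⟩
      available x y L + 𝟙 (x ∈ᵇ L) + 𝟙 (not (y ≡ᵇ x) ∧ (y ∈ᵇ L))
    ≡⟨ trans (available+hits x y L L!) |L| ⟩
      2 + X
    ∎)
    where open ≡-Reasoning

-- Counting pairs of colours

common : List ℕ → List ℕ → ℕ
common A B = count (_∈ᵇ B) A

distinctPairs : List ℕ → List ℕ → ℕ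
distinctPairs A B = ∑[ x ∈ A ] count (λ y → not (x ≡ᵇ y)) B

bonusPairs : List ℕ → List ℕ → List ℕ → ℕ
bonusPairs L A B = ∑[ x ∈ A ] count (bonus L x) B

distinctPairs+common : ∀ A B → Unique B → distinctPairs A B + common A B ≡ length A * length B
distinctPairs+common A B B! = begin
    distinctPairs A B + common A B
  ≡⟨ sym (∑-+ A _ _) ⟩
    ∑[ x ∈ A ] (count (λ y → not (x ≡ᵇ y)) B + 𝟙 (x ∈ᵇ B))
  ≡⟨ ∑-cong A (λ x → begin
      count (λ y → not (x ≡ᵇ y)) B + 𝟙 (x ∈ᵇ B)
    ≡⟨ cong (_+ 𝟙 (x ∈ᵇ B)) (∑-cong B (λ y → cong (𝟙 ∘ not) (≡ᵇ-sym x y))) ⟩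
      count (λ y → not (y ≡ᵇ x)) B + 𝟙 (x ∈ᵇ B)
    ≡⟨ count-remove (λ _ → true) x B B! ⟩
      count (λ _ → true) B
    ≡⟨ count-true B ⟩
      length B
    ∎) ⟩
    ∑[ _ ∈ A ] length B
  ≡⟨ ∑-const A (length B) ⟩
    length A * length B
  ∎
  where open ≡-Reasoning

bonus-partition : ∀ L B x → Unique B →
  count (bonus L x) B + (𝟙 (x ∈ᵇ L) * count (_∈ᵇ L) B + 𝟙 ((x ∈ᵇ B) ∧ not (x ∈ᵇ L))) ≡ length B
bonus-partition L B x B! with x ∈ᵇ L in x∈L
... | true = begin
    count (λ y → not (x ≡ᵇ y) ∧ not (y ∈ᵇ L)) B + (count (_∈ᵇ L) B + 0 + 𝟙 ((x ∈ᵇ B) ∧ false))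
  ≡⟨ cong₂ (λ c b → c + (count (_∈ᵇ L) B + 0 + 𝟙 b))
       (∑-cong B (cong 𝟙 ∘ bonus-outside)) (∧-zeroʳ (x ∈ᵇ B)) ⟩
    count (λ y → not (y ∈ᵇ L)) B + (count (_∈ᵇ L) B + 0 + 0)
  ≡⟨ cong (count (λ y → not (y ∈ᵇ L)) B +_) (trans (+-identityʳ _) (+-identityʳ _)) ⟩
    count (λ y → not (y ∈ᵇ L)) B + count (_∈ᵇ L) B
  ≡⟨ +-comm (count (λ y → not (y ∈ᵇ L)) B) _ ⟩
    count (_∈ᵇ L) B + count (λ y → not (y ∈ᵇ L)) B
  ≡⟨ sym (count-split B (λ _ → true) (_∈ᵇ L)) ⟩
    count (λ _ → true) B
  ≡⟨ count-true B ⟩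
    length B
  ∎
  where
  open ≡-Reasoning
  bonus-outside : ∀ y → not (x ≡ᵇ y) ∧ not (y ∈ᵇ L) ≡ not (y ∈ᵇ L)
  bonus-outside y with x ≡ᵇ y in e
  ... | true with ≡ᵇ-true⇒≡ x y e
  ...   | refl rewrite x∈L = refl
  bonus-outside y | false = refl
... | false = begin
    count (λ y → not (x ≡ᵇ y) ∧ true) B + 𝟙 ((x ∈ᵇ B) ∧ true)
  ≡⟨ cong₂ (λ c b → c + 𝟙 b) (∑-cong B (cong 𝟙 ∘ bonus-distinct)) (∧-identityʳ (x ∈ᵇ B)) ⟩
    count (λ y → not (y ≡ᵇ x)) B + 𝟙 (x ∈ᵇ B)
  ≡⟨ count-remove (λ _ → true) x B B! ⟩
    count (λ _ → true) B
  ≡⟨ count-true B ⟩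
    length B
  ∎
  where
  open ≡-Reasoning
  bonus-distinct : ∀ y → not (x ≡ᵇ y) ∧ true ≡ not (y ≡ᵇ x)
  bonus-distinct y = trans (∧-identityʳ _) (cong not (≡ᵇ-sym x y))

2x[x+d]≤x²+[x+d]² : ∀ x d → 2 * (x * (x + d)) ≤ x * x + (x + d) * (x + d)
2x[x+d]≤x²+[x+d]² x d = subst (2 * (x * (x + d)) ≤_) (expand x d) (m≤m+n _ (d * d))
  where
  expand : ∀ x d → 2 * (x * (x + d)) + d * d ≡ x * x + (x + d) * (x + d)
  expand = solve-∀

2xy≤x²+y² : ∀ x y → 2 * (x * y) ≤ x * x + y * y
2xy≤x²+y² x y with ≤-total x y
... | inj₁ x≤y with m≤n⇒∃[o]m+o≡n x≤y
...   | d , refl = 2x[x+d]≤x²+[x+d]² x d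
2xy≤x²+y² x y | inj₂ y≤x with m≤n⇒∃[o]m+o≡n y≤x
...   | d , refl = subst₂ _≤_ (cong (2 *_) (*-comm y (y + d))) (+-comm (y * y) _) (2x[x+d]≤x²+[x+d]² y d)


4[a+c][c+w]≤m²+3mc : ∀ a c w → let m = a + c + w in 4 * ((a + c) * (c + w)) ≤ m * m + 3 * m * c
4[a+c][c+w]≤m²+3mc a c w = +-cancelʳ-≤ (2 * (a * w)) _ _ (begin
    4 * ((a + c) * (c + w)) + 2 * (a * w)
  ≤⟨ +-monoʳ-≤ (4 * ((a + c) * (c + w))) (≤-trans (2xy≤x²+y² a w) (m≤m+n _ (c * (a + w)))) ⟩
    4 * ((a + c) * (c + w)) + (a * a + w * w + c * (a + w))
  ≡⟨ expand a c w ⟩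
    (a + c + w) * (a + c + w) + 3 * (a + c + w) * c + 2 * (a * w)
  ∎)
  where
  open ≤-Reasoning
  expand : ∀ a c w → 4 * ((a + c) * (c + w)) + (a * a + w * w + c * (a + w))
                   ≡ (a + c + w) * (a + c + w) + 3 * (a + c + w) * c + 2 * (a * w)
  expand = solve-∀

-- Used with k = |B ∩ L|, a = |(A ∩ L) ∖ B|, c = |A ∩ L ∩ B| and s = |(A ∩ B) ∖ L|.
bonusPairs-arith : ∀ W a c k s m → W + (a + c) * k + s ≡ m * m → k + a ≤ m → a + c ≤ m → 2 ≤ m →
  3 * m * m ≤ 4 * W + 3 * m * (c + s)
bonusPairs-arith W a c k s m total k+a≤m a+c≤m 2≤m with m≤n⇒∃[o]m+o≡n a+c≤m
... | w , refl = +-cancelʳ-≤ (4 * ((a + c) * k) + 4 * s) _ _ (begin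
    3 * m * m + (4 * ((a + c) * k) + 4 * s)
  ≤⟨ +-monoʳ-≤ (3 * m * m) (+-mono-≤ (*-monoʳ-≤ 4 (*-monoʳ-≤ (a + c) k≤c+w)) 4s≤3ms) ⟩
    3 * m * m + (4 * ((a + c) * (c + w)) + 3 * m * s)
  ≤⟨ +-monoʳ-≤ (3 * m * m) (+-monoˡ-≤ (3 * m * s) (4[a+c][c+w]≤m²+3mc a c w)) ⟩
    3 * m * m + (m * m + 3 * m * c + 3 * m * s)
  ≡⟨ regroup m c s ⟩
    4 * (m * m) + 3 * m * (c + s)
  ≡⟨ cong (λ z → 4 * z + 3 * m * (c + s)) (sym total) ⟩
    4 * (W + (a + c) * k + s) + 3 * m * (c + s)
  ≡⟨ distribute W ((a + c) * k) s (3 * m * (c + s)) ⟩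
    4 * W + 3 * m * (c + s) + (4 * ((a + c) * k) + 4 * s)
  ∎)
  where
  open ≤-Reasoning
  k≤c+w : k ≤ c + w
  k≤c+w = +-cancelʳ-≤ a k (c + w) (subst (k + a ≤_) (rearrange a c w) k+a≤m)
    where
    rearrange : ∀ a c w → a + c + w ≡ c + w + a
    rearrange = solve-∀
  4s≤3ms : 4 * s ≤ 3 * m * s
  4s≤3ms = *-monoˡ-≤ s (≤-trans (m≤m+n 4 2) (*-monoʳ-≤ 3 2≤m))
  regroup : ∀ m c s → 3 * m * m + (m * m + 3 * m * c + 3 * m * s) ≡ 4 * (m * m) + 3 * m * (c + s)
  regroup = solve-∀
  distribute : ∀ W p s q → 4 * (W + p + s) + q ≡ 4 * W + q + (4 * p + 4 * s)
  distribute = solve-∀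

bonusPairs-bound : ∀ m L A B → Unique L → Unique A → Unique B →
  length L ≡ m → length A ≡ m → length B ≡ m → 2 ≤ m →
  3 * m * m ≤ 4 * bonusPairs L A B + 3 * m * common A B
bonusPairs-bound m L A B L! A! B! |L| |A| |B| 2≤m =
  subst (λ z → 3 * m * m ≤ 4 * bonusPairs L A B + 3 * m * z) (sym common≡c+s)
    (bonusPairs-arith (bonusPairs L A B) a c k s m total k+a≤m a+c≤m 2≤m)
  where
  k = count (_∈ᵇ L) B
  a = count (λ x → (x ∈ᵇ L) ∧ not (x ∈ᵇ B)) A
  c = count (λ x → (x ∈ᵇ L) ∧ (x ∈ᵇ B)) A
  s = count (λ x → (x ∈ᵇ B) ∧ not (x ∈ᵇ L)) A
  common≡c+s : common A B ≡ c + s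
  common≡c+s = trans (count-split A (_∈ᵇ B) (_∈ᵇ L))
    (cong (_+ s) (∑-cong A (λ x → cong 𝟙 (∧-comm (x ∈ᵇ B) (x ∈ᵇ L)))))
  |A∩L|≡c+a : count (_∈ᵇ L) A ≡ c + a
  |A∩L|≡c+a = count-split A (_∈ᵇ L) (_∈ᵇ B)
  total : bonusPairs L A B + (a + c) * k + s ≡ m * m
  total = begin
      bonusPairs L A B + (a + c) * k + s
    ≡⟨ +-assoc (bonusPairs L A B) _ _ ⟩
      bonusPairs L A B + ((a + c) * k + s)
    ≡⟨ cong (λ z → bonusPairs L A B + (z * k + s)) (trans (+-comm a c) (sym |A∩L|≡c+a)) ⟩
      bonusPairs L A B + (count (_∈ᵇ L) A * k + s)
    ≡⟨ cong (λ z → bonusPairs L A B + (z + s)) (sym (∑-𝟙-* A (_∈ᵇ L) k)) ⟩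
      bonusPairs L A B + (∑[ x ∈ A ] (𝟙 (x ∈ᵇ L) * k) + s)
    ≡⟨ cong (bonusPairs L A B +_) (sym (∑-+ A _ _)) ⟩
      bonusPairs L A B + ∑[ x ∈ A ] (𝟙 (x ∈ᵇ L) * k + 𝟙 ((x ∈ᵇ B) ∧ not (x ∈ᵇ L)))
    ≡⟨ sym (∑-+ A _ _) ⟩
      ∑[ x ∈ A ] (count (bonus L x) B + (𝟙 (x ∈ᵇ L) * k + 𝟙 ((x ∈ᵇ B) ∧ not (x ∈ᵇ L))))
    ≡⟨ ∑-cong A (λ x → bonus-partition L B x B!) ⟩
      ∑[ _ ∈ A ] length B
    ≡⟨ ∑-const A (length B) ⟩
      length A * length B
    ≡⟨ cong₂ _*_ |A| |B| ⟩
      m * m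
    ∎
    where open ≡-Reasoning
  k+a≤m : k + a ≤ m
  k+a≤m = begin
      k + a
    ≡⟨ cong₂ _+_ (trans (∑-cong B (λ y → cong 𝟙 (sym (∧-identityʳ (y ∈ᵇ L)))))
                        (count-∈ᵇ-swap (λ _ → true) B L B! L!))
                 (count-∈ᵇ-swap (λ x → not (x ∈ᵇ B)) A L A! L!) ⟩
      count (λ z → (z ∈ᵇ B) ∧ true) L + count (λ z → (z ∈ᵇ A) ∧ not (z ∈ᵇ B)) L
    ≤⟨ count-disjoint L _ _ (λ z → disjoint (z ∈ᵇ B) (z ∈ᵇ A)) ⟩
      length L
    ≡⟨ |L| ⟩
      m
    ∎
    where
    open ≤-Reasoning
    disjoint : ∀ b a → 𝟙 (b ∧ true) + 𝟙 (a ∧ not b) ≤ 1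
    disjoint true a = ≤-reflexive (cong (λ z → 1 + 𝟙 z) (∧-zeroʳ a))
    disjoint false true = ≤-refl
    disjoint false false = z≤n
  a+c≤m : a + c ≤ m
  a+c≤m = subst₂ _≤_ (trans |A∩L|≡c+a (+-comm c a)) |A| (count≤length A (_∈ᵇ L))

-- Comparison with the standard assignment

colours : ℕ → List ℕ
colours m = map suc (upTo m)

colours! : ∀ m → Unique (colours m)
colours! m = map⁺ suc-injective (upTo⁺ m)

|colours| : ∀ m → length (colours m) ≡ m
|colours| m = trans (length-map suc (upTo m)) (length-upTo m)

pairWeight : ℕ → ℕ → ℕ → ℕ → ℕ
pairWeight α β x y = if x ≡ᵇ y then α else β

∑-pairWeight : ∀ α β A B → Unique B →
  ∑[ x ∈ A ] ∑[ y ∈ B ] pairWeight α β x y ≡ α * common A B + β * distinctPairs A B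
∑-pairWeight α β A B B! = begin
    ∑[ x ∈ A ] ∑[ y ∈ B ] pairWeight α β x y
  ≡⟨ ∑-cong A (λ x → trans (∑-cong B (split x)) (∑-+ B _ _)) ⟩
    ∑[ x ∈ A ] (∑[ y ∈ B ] (α * 𝟙 (x ≡ᵇ y)) + ∑[ y ∈ B ] (β * 𝟙 (not (x ≡ᵇ y))))
  ≡⟨ ∑-+ A _ _ ⟩
    ∑[ x ∈ A ] ∑[ y ∈ B ] (α * 𝟙 (x ≡ᵇ y)) + ∑[ x ∈ A ] ∑[ y ∈ B ] (β * 𝟙 (not (x ≡ᵇ y)))
  ≡⟨ cong₂ _+_ (trans (∑-cong A (λ x → trans (∑-*ˡ B α _) (cong (α *_) (diagonal x)))) (∑-*ˡ A α _))
               (trans (∑-cong A (λ x → ∑-*ˡ B β _)) (∑-*ˡ A β _)) ⟩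
    α * common A B + β * distinctPairs A B
  ∎
  where
  open ≡-Reasoning
  split : ∀ x y → pairWeight α β x y ≡ α * 𝟙 (x ≡ᵇ y) + β * 𝟙 (not (x ≡ᵇ y))
  split x y with x ≡ᵇ y
  ... | true = sym (trans (cong (_+ β * 0) (*-identityʳ α)) (trans (cong (α +_) (*-zeroʳ β)) (+-identityʳ α)))
  ... | false = sym (trans (cong (_+ β * 1) (*-zeroʳ α)) (*-identityʳ β))
  diagonal : ∀ x → count (x ≡ᵇ_) B ≡ 𝟙 (x ∈ᵇ B)
  diagonal x = trans (∑-cong B (λ y → cong 𝟙 (≡ᵇ-sym x y))) (count-≡ᵇ x B B!)

-- s = |L(u) ∩ L(w)|, D and q count the distinct pairs for L and for the standard assignment,
-- and SW the pairs with an extra colour.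
comparison-arith : ∀ α β Xn n m s D SW q → s ≤ m → D + s ≡ m * m → q + m ≡ m * m →
  n * (3 * m * m) ≤ 4 * SW + n * (3 * m * s) → 4 * α ≤ 4 * β + 3 * n * m * Xn →
  4 * (α * m + β * q) ≤ 4 * (α * s + β * D + Xn * SW)
comparison-arith α β Xn n m s D SW q s≤m D+s≡m² q+m≡m² SW-bound key with m≤n⇒∃[o]m+o≡n s≤m
... | t , refl = begin
    4 * (α * (s + t) + β * q)
  ≡⟨ expand α β s t q ⟩
    4 * α * s + t * (4 * α) + 4 * (β * q)
  ≤⟨ +-monoˡ-≤ (4 * (β * q)) (+-monoʳ-≤ (4 * α * s) (*-monoʳ-≤ t key)) ⟩
    4 * α * s + t * (4 * β + 3 * n * (s + t) * Xn) + 4 * (β * q)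
  ≡⟨ regroup α β Xn n s t q ⟩
    4 * α * s + 4 * β * (q + t) + Xn * (n * (3 * (s + t) * t))
  ≤⟨ +-monoʳ-≤ (4 * α * s + 4 * β * (q + t)) (*-monoʳ-≤ Xn 3nmt≤4SW) ⟩
    4 * α * s + 4 * β * (q + t) + Xn * (4 * SW)
  ≡⟨ cong (λ z → 4 * α * s + 4 * β * z + Xn * (4 * SW)) (sym D≡q+t) ⟩
    4 * α * s + 4 * β * D + Xn * (4 * SW)
  ≡⟨ collect α β Xn s D SW ⟩
    4 * (α * s + β * D + Xn * SW)
  ∎
  where
  open ≤-Reasoning
  expand : ∀ α β s t q → 4 * (α * (s + t) + β * q) ≡ 4 * α * s + t * (4 * α) + 4 * (β * q)
  expand = solve-∀
  regroup : ∀ α β Xn n s t q → 4 * α * s + t * (4 * β + 3 * n * (s + t) * Xn) + 4 * (β * q)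
                              ≡ 4 * α * s + 4 * β * (q + t) + Xn * (n * (3 * (s + t) * t))
  regroup = solve-∀
  collect : ∀ α β Xn s D SW → 4 * α * s + 4 * β * D + Xn * (4 * SW) ≡ 4 * (α * s + β * D + Xn * SW)
  collect = solve-∀
  D≡q+t : D ≡ q + t
  D≡q+t = +-cancelʳ-≡ s D (q + t)
    (trans D+s≡m² (trans (sym q+m≡m²) (trans (cong (q +_) (+-comm s t)) (sym (+-assoc q t s)))))
  3nmt≤4SW : n * (3 * (s + t) * t) ≤ 4 * SW
  3nmt≤4SW = +-cancelʳ-≤ (n * (3 * (s + t) * s)) _ _
    (subst (_≤ 4 * SW + n * (3 * (s + t) * s)) (split n s t) SW-bound)
    where
    split : ∀ n s t → n * (3 * (s + t) * (s + t)) ≡ n * (3 * (s + t) * t) + n * (3 * (s + t) * s)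
    split = solve-∀

module Comparison (X n : ℕ) where

  -- X times the number of extensions of an equal, resp. distinct, pair of colours on the
  -- 2-side for the standard assignment.
  α β : ℕ
  α = X * suc X ^ n
  β = X ^ suc n

  pair-lower : ∀ (Ls : Fin n → List ℕ) → (∀ i → Unique (Ls i)) → (∀ i → length (Ls i) ≡ 2 + X) →
    ∀ x y →
    pairWeight α β x y + X ^ n * ∑[ i ∈ allFin n ] 𝟙 (bonus (Ls i) x y) ≤ X * ∏[ i < n ] available x y (Ls i)
  pair-lower Ls Ls! |Ls| x y with x ≡ᵇ y in e | (λ i → available-lower (Ls! i) (|Ls| i) x y)
  ... | true | lower = begin
      α + X ^ n * ∑[ _ ∈ allFin n ] 0
    ≡⟨ cong (λ z → α + X ^ n * z) (trans (∑-allFin-const n 0) (*-zeroʳ n)) ⟩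
      α + X ^ n * 0
    ≡⟨ trans (cong (α +_) (*-zeroʳ (X ^ n))) (+-identityʳ α) ⟩
      X * suc X ^ n
    ≡⟨ cong (X *_) (sym (∏-const n (suc X))) ⟩
      X * ∏[ _ < n ] suc X
    ≤⟨ *-monoʳ-≤ X (∏-mono n (λ i → subst (_≤ available x y (Ls i)) X+0+1≡1+X (lower i))) ⟩
      X * ∏[ i < n ] available x y (Ls i)
    ∎
    where
    open ≤-Reasoning
    X+0+1≡1+X : X + 0 + 1 ≡ 1 + X
    X+0+1≡1+X = trans (cong (_+ 1) (+-identityʳ X)) (+-comm X 1)
  ... | false | lower =
    ∏-lower-bound-linear n X _ _ (λ i → subst (_≤ available x y (Ls i)) (+-identityʳ _) (lower i))

  pair-upper : ∀ {U} → Unique U → length U ≡ 2 + X → ∀ {x y} → (x ∈ᵇ U) ≡ true → (y ∈ᵇ U) ≡ true →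
    X * ∏[ _ < n ] available x y U ≤ pairWeight α β x y
  pair-upper U! |U| {x} {y} x∈U y∈U with x ≡ᵇ y | available-members U! |U| x∈U y∈U
  ... | true | avail≡ = ≤-reflexive (cong (X *_)
        (trans (∏-cong n (λ _ → trans (sym (+-identityʳ _)) avail≡)) (∏-const n (suc X))))
  ... | false | avail≡ = ≤-reflexive (cong (X *_)
        (trans (∏-cong n (λ _ → +-cancelʳ-≡ 1 _ _ (trans avail≡ (+-comm 1 X)))) (∏-const n X)))

  lower-sum : ∀ A B (Ls : Fin n → List ℕ) →
    Unique B → (∀ i → Unique (Ls i)) → (∀ i → length (Ls i) ≡ 2 + X) →
    α * common A B + β * distinctPairs A B + X ^ n * ∑[ i ∈ allFin n ] bonusPairs (Ls i) A B
      ≤ X * ∑[ x ∈ A ] ∑[ y ∈ B ] ∏[ i < n ] available x y (Ls i)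
  lower-sum A B Ls B! Ls! |Ls| = begin
      α * common A B + β * distinctPairs A B + X ^ n * ∑[ i ∈ allFin n ] bonusPairs (Ls i) A B
    ≡⟨ cong₂ _+_ (sym (∑-pairWeight α β A B B!)) (cong (X ^ n *_) bonus-swap) ⟩
      ∑[ x ∈ A ] ∑[ y ∈ B ] pairWeight α β x y + X ^ n * ∑[ x ∈ A ] ∑[ y ∈ B ] bonuses x y
    ≡⟨ sym (trans (∑-cong A (λ x → ∑-+-*ˡ B _ (X ^ n) _)) (∑-+-*ˡ A _ (X ^ n) _)) ⟩
      ∑[ x ∈ A ] ∑[ y ∈ B ] (pairWeight α β x y + X ^ n * bonuses x y)
    ≤⟨ ∑-mono′ A (λ x → ∑-mono′ B (λ y → pair-lower Ls Ls! |Ls| x y)) ⟩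
      ∑[ x ∈ A ] ∑[ y ∈ B ] (X * ∏[ i < n ] available x y (Ls i))
    ≡⟨ trans (∑-cong A (λ x → ∑-*ˡ B X _)) (∑-*ˡ A X _) ⟩
      X * ∑[ x ∈ A ] ∑[ y ∈ B ] ∏[ i < n ] available x y (Ls i)
    ∎
    where
    open ≤-Reasoning
    bonuses : ℕ → ℕ → ℕ
    bonuses x y = ∑[ i ∈ allFin n ] 𝟙 (bonus (Ls i) x y)
    bonus-swap : ∑[ i ∈ allFin n ] bonusPairs (Ls i) A B ≡ ∑[ x ∈ A ] ∑[ y ∈ B ] bonuses x y
    bonus-swap = trans (∑-comm (allFin n) A _) (∑-cong A (λ x → ∑-comm (allFin n) B _))

  upper-sum : ∀ U → Unique U → length U ≡ 2 + X →
    X * ∑[ x ∈ U ] ∑[ y ∈ U ] ∏[ _ < n ] available x y U ≤ α * (2 + X) + β * distinctPairs U U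
  upper-sum U U! |U| = begin
      X * ∑[ x ∈ U ] ∑[ y ∈ U ] ∏[ _ < n ] available x y U
    ≡⟨ sym (trans (∑-cong U (λ x → ∑-*ˡ U X _)) (∑-*ˡ U X _)) ⟩
      ∑[ x ∈ U ] ∑[ y ∈ U ] (X * ∏[ _ < n ] available x y U)
    ≤⟨ ∑-mono (All.map (λ x∈U → ∑-mono (All.map (pair-upper U! |U| x∈U) (∈ᵇ-self U))) (∈ᵇ-self U)) ⟩
      ∑[ x ∈ U ] ∑[ y ∈ U ] pairWeight α β x y
    ≡⟨ ∑-pairWeight α β U U U! ⟩
      α * common U U + β * distinctPairs U U
    ≡⟨ cong (λ c → α * c + β * distinctPairs U U) (trans (count-all (_∈ᵇ U) (∈ᵇ-self U)) |U|) ⟩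
      α * (2 + X) + β * distinctPairs U U
    ∎
    where open ≤-Reasoning

  chrom≤P : .{{_ : NonZero X}} → 4 * α ≤ 4 * β + 3 * n * (2 + X) * X ^ n →
    ∀ L → IsAssignment (K2 n) (2 + X) L → chrom (K2 n) (2 + X) ≤ P[ K2 n , L ]
  chrom≤P key L L-assignment = subst₂ _≤_ (sym (P-K2 n (λ _ → U))) (sym (P-K2 n L))
    (*-cancelˡ-≤ X (*-cancelˡ-≤ 4 (begin
      4 * (X * ∑[ x ∈ U ] ∑[ y ∈ U ] ∏[ _ < n ] available x y U)
    ≤⟨ *-monoʳ-≤ 4 (upper-sum U U! |U|) ⟩
      4 * (α * m + β * distinctPairs U U)
    ≤⟨ comparison-arith α β (X ^ n) n m (common L₀ L₁) (distinctPairs L₀ L₁) SW (distinctPairs U U)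
         common≤m (D+s≡m² L₀ L₁ L₁! |L₀| |L₁|) q+m≡m²
         SW-bound key ⟩
      4 * (α * common L₀ L₁ + β * distinctPairs L₀ L₁ + X ^ n * SW)
    ≤⟨ *-monoʳ-≤ 4 (lower-sum L₀ L₁ Ls L₁! Ls! |Ls|) ⟩
      4 * (X * ∑[ x ∈ L₀ ] ∑[ y ∈ L₁ ] ∏[ i < n ] available x y (Ls i))
    ∎)))
    where
    open ≤-Reasoning
    m = 2 + X
    U = colours m
    U! = colours! m
    |U| = |colours| m
    L₀ = L fz
    L₁ = L (fs fz)
    Ls : Fin n → List ℕ
    Ls i = L (fs (fs i))
    L₀! = proj₁ (L-assignment fz)
    L₁! = proj₁ (L-assignment (fs fz))
    Ls! = λ i → proj₁ (L-assignment (fs (fs i)))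
    |L₀| = proj₂ (L-assignment fz)
    |L₁| = proj₂ (L-assignment (fs fz))
    |Ls| = λ i → proj₂ (L-assignment (fs (fs i)))
    SW = ∑[ i ∈ allFin n ] bonusPairs (Ls i) L₀ L₁
    D+s≡m² : ∀ P Q → Unique Q → length P ≡ m → length Q ≡ m → distinctPairs P Q + common P Q ≡ m * m
    D+s≡m² P Q Q! |P| |Q| = trans (distinctPairs+common P Q Q!) (cong₂ _*_ |P| |Q|)
    common≤m : common L₀ L₁ ≤ m
    common≤m = subst (common L₀ L₁ ≤_) |L₀| (count≤length L₀ (_∈ᵇ L₁))
    q+m≡m² : distinctPairs U U + m ≡ m * m
    q+m≡m² = trans (cong (distinctPairs U U +_) (sym (trans (count-all (_∈ᵇ U) (∈ᵇ-self U)) |U|)))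
      (D+s≡m² U U U! |U| |U|)
    SW-bound : n * (3 * m * m) ≤ 4 * SW + n * (3 * m * common L₀ L₁)
    SW-bound = begin
        n * (3 * m * m)
      ≡⟨ sym (∑-allFin-const n _) ⟩
        ∑[ _ ∈ allFin n ] (3 * m * m)
      ≤⟨ ∑-mono′ (allFin n) (λ i →
           bonusPairs-bound m (Ls i) L₀ L₁ (Ls! i) L₀! L₁! (|Ls| i) |L₀| |L₁| (m≤m+n 2 X)) ⟩
        ∑[ i ∈ allFin n ] (4 * bonusPairs (Ls i) L₀ L₁ + 3 * m * common L₀ L₁)
      ≡⟨ trans (∑-+ (allFin n) _ _) (cong₂ _+_ (∑-*ˡ (allFin n) 4 _) (∑-allFin-const n _)) ⟩
        4 * SW + n * (3 * m * common L₀ L₁)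
      ∎

-- The numerical condition

small : ∀ (X : Fin 10) (j : Fin 11) → 100 * toℕ j + 57 ≤ 124 * toℕ X →
  4 * suc (toℕ X) ^ toℕ j ≤ 3 * (2 + toℕ X) * toℕ X ^ toℕ j
small = from-yes (all? {n = 10} λ X → all? {n = 11} λ j →
  (100 * toℕ j + 57 ≤? 124 * toℕ X)
    →-dec (4 * suc (toℕ X) ^ toℕ j ≤? 3 * (2 + toℕ X) * toℕ X ^ toℕ j))

[1+X]^[1+j]≤X^[1+j]+[1+j]*[1+X]^j : ∀ X j → suc X ^ suc j ≤ X ^ suc j + suc j * suc X ^ j
[1+X]^[1+j]≤X^[1+j]+[1+j]*[1+X]^j X zero = ≤-reflexive (base X)
  where
  base : ∀ X → (1 + X) * 1 ≡ X * 1 + 1 * 1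
  base = solve-∀
[1+X]^[1+j]≤X^[1+j]+[1+j]*[1+X]^j X (suc j) = begin
    suc X * suc X ^ suc j
  ≤⟨ *-monoʳ-≤ (suc X) ([1+X]^[1+j]≤X^[1+j]+[1+j]*[1+X]^j X j) ⟩
    suc X * (X ^ suc j + suc j * suc X ^ j)
  ≡⟨ expand X (X ^ suc j) j (suc X ^ j) ⟩
    X * X ^ suc j + (X ^ suc j + suc j * (suc X * suc X ^ j))
  ≤⟨ +-monoʳ-≤ (X * X ^ suc j) (+-monoˡ-≤ _ (^-monoˡ-≤ (suc j) (n≤1+n X))) ⟩
    X * X ^ suc j + (suc X ^ suc j + suc j * (suc X * suc X ^ j))
  ∎
  where
  open ≤-Reasoning
  expand : ∀ X Y j Z → (1 + X) * (Y + (1 + j) * Z) ≡ X * Y + (Y + (1 + j) * ((1 + X) * Z))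
  expand = solve-∀

[1+X]^a*r≤X^a*[1+X] : ∀ X a r → a + r ≡ suc X → suc X ^ a * r ≤ X ^ a * suc X
[1+X]^a*r≤X^a*[1+X] X zero r r≡1+X =
  ≤-reflexive (trans (*-identityˡ r) (trans r≡1+X (sym (*-identityˡ (suc X)))))
[1+X]^a*r≤X^a*[1+X] X (suc a) r a+r≡X = begin
    suc X * suc X ^ a * r
  ≡⟨ rearrange X (suc X ^ a) r ⟩
    suc X ^ a * (suc X * r)
  ≤⟨ *-monoʳ-≤ (suc X ^ a) [1+X]r≤X[1+r] ⟩
    suc X ^ a * (X * suc r)
  ≡⟨ x*[y*z]≡y*[x*z] (suc X ^ a) X (suc r) ⟩
    X * (suc X ^ a * suc r)
  ≤⟨ *-monoʳ-≤ X ([1+X]^a*r≤X^a*[1+X] X a (suc r) (trans (+-suc a r) a+r≡X)) ⟩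
    X * (X ^ a * suc X)
  ≡⟨ sym (*-assoc X (X ^ a) (suc X)) ⟩
    X * X ^ a * suc X
  ∎
  where
  open ≤-Reasoning
  rearrange : ∀ X Y r → (1 + X) * Y * r ≡ Y * ((1 + X) * r)
  rearrange = solve-∀
  [1+X]r≤X[1+r] : suc X * r ≤ X * suc r
  [1+X]r≤X[1+r] = subst₂ _≤_ (+-comm (X * r) r) (trans (+-comm (X * r) X) (sym (*-suc X r)))
    (+-monoʳ-≤ (X * r) (subst (r ≤_) (suc-injective a+r≡X) (m≤n+m r a)))

[1+X]^b≤3*X^b : ∀ X b → 3 * b ≤ 2 * suc X → suc X ^ b ≤ 3 * X ^ b
[1+X]^b≤3*X^b X b 3b≤2[1+X] with m≤n⇒∃[o]m+o≡n b≤1+X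
  where
  b≤1+X : b ≤ suc X
  b≤1+X = *-cancelˡ-≤ 3 (≤-trans 3b≤2[1+X] (*-monoˡ-≤ (suc X) (n≤1+n 2)))
... | r , b+r≡1+X = *-cancelʳ-≤ (suc X ^ b) (3 * X ^ b) (suc X) (begin
    suc X ^ b * suc X
  ≤⟨ *-monoʳ-≤ (suc X ^ b) 1+X≤3r ⟩
    suc X ^ b * (3 * r)
  ≡⟨ x*[y*z]≡y*[x*z] (suc X ^ b) 3 r ⟩
    3 * (suc X ^ b * r)
  ≤⟨ *-monoʳ-≤ 3 ([1+X]^a*r≤X^a*[1+X] X b r b+r≡1+X) ⟩
    3 * (X ^ b * suc X)
  ≡⟨ sym (*-assoc 3 (X ^ b) (suc X)) ⟩
    3 * X ^ b * suc X
  ∎)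
  where
  open ≤-Reasoning
  1+X≤3r : suc X ≤ 3 * r
  1+X≤3r = +-cancelˡ-≤ (2 * suc X) _ _ (begin
      2 * suc X + suc X
    ≡⟨ +-comm (2 * suc X) (suc X) ⟩
      3 * suc X
    ≡⟨ cong (3 *_) (sym b+r≡1+X) ⟩
      3 * (b + r)
    ≡⟨ *-distribˡ-+ 3 b r ⟩
      3 * b + 3 * r
    ≤⟨ +-monoˡ-≤ (3 * r) 3b≤2[1+X] ⟩
      2 * suc X + 3 * r
    ∎)

2*⌈n/2⌉≤1+n : ∀ n → 2 * ⌈ n /2⌉ ≤ suc n
2*⌈n/2⌉≤1+n zero = z≤n
2*⌈n/2⌉≤1+n (suc zero) = ≤-refl
2*⌈n/2⌉≤1+n (suc (suc n)) = ≤-trans (≤-reflexive (*-suc 2 ⌈ n /2⌉)) (s≤s (s≤s (2*⌈n/2⌉≤1+n n)))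

[1+X]^j≤9*X^j : ∀ X j → 3 * j ≤ 4 * X → suc X ^ j ≤ 9 * X ^ j
[1+X]^j≤9*X^j X j 3j≤4X = begin
    suc X ^ j
  ≡⟨ cong (suc X ^_) (sym (⌊n/2⌋+⌈n/2⌉≡n j)) ⟩
    suc X ^ (⌊ j /2⌋ + ⌈ j /2⌉)
  ≡⟨ ^-distribˡ-+-* (suc X) ⌊ j /2⌋ ⌈ j /2⌉ ⟩
    suc X ^ ⌊ j /2⌋ * suc X ^ ⌈ j /2⌉
  ≤⟨ *-mono-≤ ([1+X]^b≤3*X^b X ⌊ j /2⌋ (≤-trans (*-monoʳ-≤ 3 (⌊n/2⌋≤⌈n/2⌉ j)) 3⌈j/2⌉≤2[1+X]))
              ([1+X]^b≤3*X^b X ⌈ j /2⌉ 3⌈j/2⌉≤2[1+X]) ⟩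
    3 * X ^ ⌊ j /2⌋ * (3 * X ^ ⌈ j /2⌉)
  ≡⟨ [m*n]*[o*p]≡[m*o]*[n*p] 3 (X ^ ⌊ j /2⌋) 3 (X ^ ⌈ j /2⌉) ⟩
    9 * (X ^ ⌊ j /2⌋ * X ^ ⌈ j /2⌉)
  ≡⟨ cong (9 *_) (trans (sym (^-distribˡ-+-* X ⌊ j /2⌋ ⌈ j /2⌉)) (cong (X ^_) (⌊n/2⌋+⌈n/2⌉≡n j))) ⟩
    9 * X ^ j
  ∎
  where
  open ≤-Reasoning
  3⌈j/2⌉≤2[1+X] : 3 * ⌈ j /2⌉ ≤ 2 * suc X
  3⌈j/2⌉≤2[1+X] = *-cancelˡ-≤ 2 (begin
      2 * (3 * ⌈ j /2⌉)
    ≡⟨ x*[y*z]≡y*[x*z] 2 3 ⌈ j /2⌉ ⟩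
      3 * (2 * ⌈ j /2⌉)
    ≤⟨ *-monoʳ-≤ 3 (2*⌈n/2⌉≤1+n j) ⟩
      3 * suc j
    ≡⟨ *-suc 3 j ⟩
      3 + 3 * j
    ≤⟨ +-mono-≤ (n≤1+n 3) 3j≤4X ⟩
      4 + 4 * X
    ≡⟨ regroup X ⟩
      2 * (2 * suc X)
    ∎)
    where
    regroup : ∀ X → 4 + 4 * X ≡ 2 * (2 * (1 + X))
    regroup = solve-∀

-- For X ≥ 10 it suffices that (1 + 1/X)ʲ ≤ 9.
4[1+X]^j≤3[2+X]X^j : ∀ X j → 100 * j + 57 ≤ 124 * X → 4 * suc X ^ j ≤ 3 * (2 + X) * X ^ j
4[1+X]^j≤3[2+X]X^j X j h with X <? 10
... | yes X<10 = subst₂ (λ X j → 100 * j + 57 ≤ 124 * X → 4 * suc X ^ j ≤ 3 * (2 + X) * X ^ j)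
      (toℕ-fromℕ< X<10) (toℕ-fromℕ< j<11) (small (fromℕ< X<10) (fromℕ< j<11)) h
  where
  j<11 : j < 11
  j<11 = *-cancelˡ-< 100 j 11 (+-cancelʳ-< 57 (100 * j) (100 * 11)
           (≤-<-trans h (≤-<-trans (*-monoʳ-≤ 124 (≤-pred X<10)) (from-yes (124 * 9 <? 100 * 11 + 57)))))
... | no X≮10 = begin
    4 * suc X ^ j
  ≤⟨ *-monoʳ-≤ 4 ([1+X]^j≤9*X^j X j 3j≤4X) ⟩
    4 * (9 * X ^ j)
  ≡⟨ sym (*-assoc 4 9 (X ^ j)) ⟩
    36 * X ^ j
  ≤⟨ *-monoˡ-≤ (X ^ j) (*-monoʳ-≤ 3 (+-monoʳ-≤ 2 (≮⇒≥ X≮10))) ⟩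
    3 * (2 + X) * X ^ j
  ∎
  where
  open ≤-Reasoning
  3j≤4X : 3 * j ≤ 4 * X
  3j≤4X = *-cancelˡ-≤ 100 (begin
      100 * (3 * j)
    ≡⟨ x*[y*z]≡y*[x*z] 100 3 j ⟩
      3 * (100 * j)
    ≤⟨ *-monoʳ-≤ 3 (≤-trans (m≤m+n (100 * j) 57) h) ⟩
      3 * (124 * X)
    ≡⟨ sym (*-assoc 3 124 X) ⟩
      372 * X
    ≤⟨ *-monoˡ-≤ X (from-yes (372 ≤? 400)) ⟩
      400 * X
    ≡⟨ *-assoc 100 4 X ⟩
      100 * (4 * X)
    ∎)

key-inequality : ∀ X j → 100 * j + 57 ≤ 124 * X →
  4 * (X * suc X ^ suc j) ≤ 4 * X ^ suc (suc j) + 3 * suc j * (2 + X) * X ^ suc j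
key-inequality X j h = begin
    4 * (X * suc X ^ suc j)
  ≤⟨ *-monoʳ-≤ 4 (*-monoʳ-≤ X ([1+X]^[1+j]≤X^[1+j]+[1+j]*[1+X]^j X j)) ⟩
    4 * (X * (X ^ suc j + suc j * suc X ^ j))
  ≡⟨ expand X (X ^ suc j) (suc j) (suc X ^ j) ⟩
    4 * (X * X ^ suc j) + suc j * X * (4 * suc X ^ j)
  ≤⟨ +-monoʳ-≤ (4 * (X * X ^ suc j)) (*-monoʳ-≤ (suc j * X) (4[1+X]^j≤3[2+X]X^j X j h)) ⟩
    4 * (X * X ^ suc j) + suc j * X * (3 * (2 + X) * X ^ j)
  ≡⟨ cong (4 * (X * X ^ suc j) +_) (regroup X (X ^ j) (suc j)) ⟩
    4 * (X * X ^ suc j) + 3 * suc j * (2 + X) * (X * X ^ j)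
  ∎
  where
  open ≤-Reasoning
  expand : ∀ X Y J Z → 4 * (X * (Y + J * Z)) ≡ 4 * (X * Y) + J * X * (4 * Z)
  expand = solve-∀
  regroup : ∀ X Y J → J * X * (3 * (2 + X) * Y) ≡ 3 * J * (2 + X) * (X * Y)
  regroup = solve-∀

-- The threshold

K2-colorable : ∀ n k → 2 ≤ k → Colorable (K2 n) k
K2-colorable n (suc (suc k)) _ = colour , proper
  where
  colour : Fin (2 + n) → Fin (suc (suc k))
  colour v = if side v then fz else fs fz
  proper : Proper (K2 n) (λ v → toℕ (colour v))
  proper u v uv same with side u | side v
  proper u v () _ | true | true
  proper u v _ () | true | false
  proper u v _ () | false | true
  proper u v () _ | false | false
K2-colorable n 0 ()
K2-colorable n 1 (s≤s ())

a≤ceilDiv[a,1+b]*[1+b] : ∀ a b → a ≤ ceilDiv a (suc b) * suc b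
a≤ceilDiv[a,1+b]*[1+b] a b = +-cancelʳ-≤ b a _ (begin
    a + b
  ≡⟨ m≡m%n+[m/n]*n (a + b) (suc b) ⟩
    (a + b) % suc b + (a + b) / suc b * suc b
  ≤⟨ +-monoˡ-≤ _ (≤-pred (m%n<n (a + b) (suc b))) ⟩
    b + (a + b) / suc b * suc b
  ≡⟨ +-comm b _ ⟩
    (a + b) / suc b * suc b + b
  ∎)
  where open ≤-Reasoning

bound-spec : ∀ n m → bound n ≤ m → 100 * n + 205 ≤ m * 124
bound-spec n m bound≤m = ≤-trans (a≤ceilDiv[a,1+b]*[1+b] (100 * n + 205) 123) (*-monoˡ-≤ 124 bound≤m)

248<100[1+j]+205 : ∀ j → 2 * 124 < 100 * suc j + 205
248<100[1+j]+205 j = ≤-trans (from-yes (2 * 124 <? 100 * 1 + 205)) (+-monoˡ-≤ 205 (*-monoʳ-≤ 100 (s≤s z≤n)))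

too-few-colours : ∀ j m → m ≤ 2 → ¬ (100 * suc j + 205 ≤ m * 124)
too-few-colours j m m≤2 h = <⇒≱ (≤-<-trans (*-monoˡ-≤ 124 m≤2) (248<100[1+j]+205 j)) h

chrom≤P-K2 : ∀ j m → 100 * suc j + 205 ≤ m * 124 →
  ∀ L → IsAssignment (K2 (suc j)) m L → chrom (K2 (suc j)) m ≤ P[ K2 (suc j) , L ]
chrom≤P-K2 j (suc (suc (suc X))) h =
  Comparison.chrom≤P (suc X) (suc j)
    (key-inequality (suc X) j (+-cancelʳ-≤ 248 _ _ (subst₂ _≤_ (shift-j j) (shift-X X) h)))
  where
  shift-j : ∀ j → 100 * (1 + j) + 205 ≡ 100 * j + 57 + 248
  shift-j = solve-∀
  shift-X : ∀ X → (3 + X) * 124 ≡ 124 * (1 + X) + 248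
  shift-X = solve-∀
chrom≤P-K2 j 0 h = ⊥-elim (too-few-colours j 0 z≤n h)
chrom≤P-K2 j 1 h = ⊥-elim (too-few-colours j 1 (s≤s z≤n) h)
chrom≤P-K2 j 2 h = ⊥-elim (too-few-colours j 2 ≤-refl h)

theorem9 : (n : ℕ) → 2 ≤ n → ThresholdAtMost (K2 n) (bound n)
theorem9 n@(suc j) _ = bound n , K2-colorable n (bound n) 2≤bound , ≤-refl ,
  λ m bound≤m → ((λ _ → colours m) , (λ _ → colours! m , |colours| m) , refl)
              , chrom≤P-K2 j m (bound-spec n m bound≤m)
  where
  2≤bound : 2 ≤ bound n
  2≤bound = *-cancelʳ-≤ 2 (bound n) 124
    (<⇒≤ (<-≤-trans (248<100[1+j]+205 j) (bound-spec n (bound n) ≤-refl)))
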